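{- (Classification for $\mathbf{V}$.) Let $\Gamma_\to$ be an implicative typing context, and let $\Gamma_\to\vdash_{\mathbf{V}} t:A$ with $t$ in $\to_{\mathbf{V}}$-normal form and $t$ not $\to$neutral. Then: if $A=B\to C$, $t$ is either an abstraction or a variable declared in $\Gamma_\to$; if $A=B\lor C$, $t$ is an injection $\mathtt{in}_i t'$; if $A=B\land C$, $t$ is a pair $\langle t_1,t_2\rangle$.
   Context: Formulas are built from propositional atoms and $\bot$ using $\to,\land,\lor$. Terms of $\mathbf{V}$: $t,s,u ::= x \mid t\,s \mid \lambda x.t \mid \mathtt{efq}(t) \mid \langle t,s\rangle \mid \pi_i t \mid \mathtt{in}_i t \mid \mathtt{case}\ t\ [y.s_1]\ [y.s_2] \mid \mathtt{V}_n(\vec x.t,\ y.s_1,\ y.s_2,\ z.\vec u)$ ($i\in\{1,2\}$, $n\ge1$), with $\vec x=x_1,\dots,x_n$ bound in $t$, $y$ in $s_1,s_2$, $z$ in each $u_1,\dots,u_n$; $t\{x:=s\}$ is capture-avoiding substitution. Notation: $\lambda\vec x.t:=\lambda x_1.\cdots\lambda x_n.t$ and $(B_i\to C_i)_{i=1\dots n}\to E := (B_1\to C_1)\to(\cdots\to((B_n\to C_n)\to E))$. Typing $\vdash_{\mathbf{V}}$: standard natural-deduction rules of intuitionistic propositional logic (axiom; $\lambda$ for $\to_I$; application for $\to_E$; pairs for $\land_I$; $\pi_i t:A_i$ from $t:A_1\land A_2$; $\mathtt{in}_i t:A_1\lor A_2$ from $t:A_i$; $\mathtt{case}\,t\,[y.s_1][y.s_2]:D$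 from $t:A_1\lor A_2$ and $\Gamma,y:A_i\vdash s_i:D$; $\mathtt{efq}(t):A$ from $t:\bot$), plus Visser$_n$: from $x_1:B_1\to C_1,\dots,x_n:B_n\to C_n\vdash t:A_1\lor A_2$ (exactly these assumptions), $\Gamma,y:(B_i\to C_i)_{i}\to A_1\vdash s_1:D$, $\Gamma,y:(B_i\to C_i)_{i}\to A_2\vdash s_2:D$, and $\Gamma,z:(B_i\to C_i)_{i}\to B_j\vdash u_j:D$ for each $j$, infer $\Gamma\vdash \mathtt{V}_n(\vec x.t,y.s_1,y.s_2,z.\vec u):D$. Weak head contexts: $W::=\Box\mid W\,t\mid \pi_i W\mid \mathtt{case}\ W\ [y.s_1]\ [y.s_2]$, $W\langle t\rangle$ filling the hole. Top-level reductions: $(\lambda x.t)s\mapsto t\{x:=s\}$; $\pi_i\langle t_1,t_2\rangle\mapsto t_i$; $\mathtt{case}\,(\mathtt{in}_i t)\,[y.s_1][y.s_2]\mapsto s_i\{y:=t\}$; $\mathtt{V}_n(\vec x.\mathtt{in}_i t, \dots)\mapsto s_i\{y:=\lambda\vec x.t\}$; $\mathtt{V}_n(\vec x.W\langle\mathtt{efq}(t)\rangle,\dots)\mapsto s_1\{y:=\lambda\vec x.\mathtt{efq}(t)\}$; $\mathtt{V}_n(\vec x.W\langle x_j\,t\rangle,\dots)\mapsto u_j\{z:=\lambda\vec x.t\}$. $\to_{\mathbf{V}}$ is their closure under all term constructors. An implicative typing context is one of the form $\{x_1:A_1\to B_1,\dots,x_n:A_n\to B_n\}$. A term is $\to$neutral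 if it has the form $W\langle x\,s\rangle$ or $W\langle\mathtt{efq}(s)\rangle$ for a weak head context $W$, a variable $x$ and a term $s$. -}

module Defs where

open import Data.Nat using (ℕ; zero; suc; _∸_)
open import Data.Fin using (Fin; toℕ)
open import Data.Vec using (Vec; []; _∷_; lookup; toList)
import Data.Vec as Vec
open import Data.List using (List; []; _∷_; reverse)
open import Data.List.Relation.Unary.All using (All)
open import Data.Product using (_×_; _,_; proj₁; proj₂; ∃; ∃-syntax; Σ)
open import Data.Sum using (_⊎_)
open import Relation.Binary.PropositionalEquality using (_≡_)
open import Relation.Nullary using (¬_)

infixr 7 _⇒_
infixr 8 _∨_
infixr 9 _∧_

data Form : Set where
  atom : ℕ → Form
  ⊥f   : Form
  _⇒_  : Form → Form → Form
  _∧_  : Form → Form → Form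
  _∨_  : Form → Form → Form

-- Terms of V, de Bruijn indices (index 0 = innermost binder).
-- Components index i ∈ {1,2}:

data Idx : Set where
  one two : Idx

sel : {A : Set} → Idx → A → A → A
sel one a b = a
sel two a b = b

-- V n t s₁ s₂ us  represents  V_{n+1}(x₁…x_{n+1}.t, y.s₁, y.s₂, z.us)
-- (so the arity n+1 ≥ 1).  t is under n+1 binders: x_{j} (j = 1…n+1)
-- is the de Bruijn index (n+1) - j, i.e. x_{n+1} is index 0.
-- s₁, s₂ and each element of us are under one binder (y resp. z).
data Term : Set where
  var  : ℕ → Term
  app  : Term → Term → Term
  lam  : Term → Term
  efq  : Term → Term
  pair : Term → Term → Term
  proj : Idx → Term → Term
  inj  : Idx → Term → Term
  case : Term → Term → Term → Term
  V    : (n : ℕ) → Term → Term → Term → Vec Term (suc n) → Term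

ext : (ℕ → ℕ) → ℕ → ℕ
ext ρ zero    = zero
ext ρ (suc k) = suc (ρ k)

extN : ℕ → (ℕ → ℕ) → ℕ → ℕ
extN zero    ρ = ρ
extN (suc m) ρ = ext (extN m ρ)

mutual
  rename : (ℕ → ℕ) → Term → Term
  rename ρ (var k)        = var (ρ k)
  rename ρ (app t s)      = app (rename ρ t) (rename ρ s)
  rename ρ (lam t)        = lam (rename (ext ρ) t)
  rename ρ (efq t)        = efq (rename ρ t)
  rename ρ (pair t s)     = pair (rename ρ t) (rename ρ s)
  rename ρ (proj i t)     = proj i (rename ρ t)
  rename ρ (inj i t)      = inj i (rename ρ t)
  rename ρ (case t s₁ s₂) = case (rename ρ t) (rename (ext ρ) s₁) (rename (ext ρ) s₂)
  rename ρ (V n t s₁ s₂ us) =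
    V n (rename (extN (suc n) ρ) t) (rename (ext ρ) s₁) (rename (ext ρ) s₂) (renameVec (ext ρ) us)

  renameVec : ∀ {m} → (ℕ → ℕ) → Vec Term m → Vec Term m
  renameVec ρ []       = []
  renameVec ρ (u ∷ us) = rename ρ u ∷ renameVec ρ us

exts : (ℕ → Term) → ℕ → Term
exts σ zero    = var zero
exts σ (suc k) = rename suc (σ k)

extsN : ℕ → (ℕ → Term) → ℕ → Term
extsN zero    σ = σ
extsN (suc m) σ = exts (extsN m σ)

mutual
  subst : (ℕ → Term) → Term → Term
  subst σ (var k)        = σ k
  subst σ (app t s)      = app (subst σ t) (subst σ s)
  subst σ (lam t)        = lam (subst (exts σ) t)
  subst σ (efq t)        = efq (subst σ t)
  subst σ (pair t s)     = pair (subst σ t) (subst σ s)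
  subst σ (proj i t)     = proj i (subst σ t)
  subst σ (inj i t)      = inj i (subst σ t)
  subst σ (case t s₁ s₂) = case (subst σ t) (subst (exts σ) s₁) (subst (exts σ) s₂)
  subst σ (V n t s₁ s₂ us) =
    V n (subst (extsN (suc n) σ) t) (subst (exts σ) s₁) (subst (exts σ) s₂) (substVec (exts σ) us)

  substVec : ∀ {m} → (ℕ → Term) → Vec Term m → Vec Term m
  substVec σ []       = []
  substVec σ (u ∷ us) = subst σ u ∷ substVec σ us

σ₀ : Term → ℕ → Term
σ₀ s zero    = s
σ₀ s (suc k) = var k

_[_] : Term → Term → Term
t [ s ] = subst (σ₀ s) t

lams : ℕ → Term → Term
lams zero    t = t
lams (suc m) t = lam (lams m t)

data WCtx : Set where
  □     : WCtx
  appW  : WCtx → Term → WCtx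
  projW : Idx → WCtx → WCtx
  caseW : WCtx → Term → Term → WCtx

fill : WCtx → Term → Term
fill □              t = t
fill (appW W s)     t = app (fill W t) s
fill (projW i W)    t = proj i (fill W t)
fill (caseW W s₁ s₂) t = case (fill W t) s₁ s₂

-- the de Bruijn index of x_{j+1} under the n+1 binders of V n
xIdx : (n : ℕ) → Fin (suc n) → ℕ
xIdx n j = n ∸ toℕ j

infix 4 _↦_ _⟶_ _⟶v_

data _↦_ : Term → Term → Set where
  β     : ∀ t s → app (lam t) s ↦ t [ s ]
  πβ    : ∀ i t₁ t₂ → proj i (pair t₁ t₂) ↦ sel i t₁ t₂
  caseβ : ∀ i t s₁ s₂ → case (inj i t) s₁ s₂ ↦ (sel i s₁ s₂) [ t ]
  Vin   : ∀ n i t s₁ s₂ us → V n (inj i t) s₁ s₂ us ↦ (sel i s₁ s₂) [ lams (suc n) t ]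
  Vefq  : ∀ n W t s₁ s₂ us →
          V n (fill W (efq t)) s₁ s₂ us ↦ s₁ [ lams (suc n) (efq t) ]
  Vapp  : ∀ n W (j : Fin (suc n)) t s₁ s₂ us →
          V n (fill W (app (var (xIdx n j)) t)) s₁ s₂ us ↦ (lookup us j) [ lams (suc n) t ]

mutual
  data _⟶_ : Term → Term → Set where
    top   : ∀ {t t'} → t ↦ t' → t ⟶ t'
    appL  : ∀ {t t' s} → t ⟶ t' → app t s ⟶ app t' s
    appR  : ∀ {t s s'} → s ⟶ s' → app t s ⟶ app t s'
    lamC  : ∀ {t t'} → t ⟶ t' → lam t ⟶ lam t'
    efqC  : ∀ {t t'} → t ⟶ t' → efq t ⟶ efq t'
    pairL : ∀ {t t' s} → t ⟶ t' → pair t s ⟶ pair t' s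
    pairR : ∀ {t s s'} → s ⟶ s' → pair t s ⟶ pair t s'
    projC : ∀ {i t t'} → t ⟶ t' → proj i t ⟶ proj i t'
    injC  : ∀ {i t t'} → t ⟶ t' → inj i t ⟶ inj i t'
    case0 : ∀ {t t' s₁ s₂} → t ⟶ t' → case t s₁ s₂ ⟶ case t' s₁ s₂
    case1 : ∀ {t s₁ s₁' s₂} → s₁ ⟶ s₁' → case t s₁ s₂ ⟶ case t s₁' s₂
    case2 : ∀ {t s₁ s₂ s₂'} → s₂ ⟶ s₂' → case t s₁ s₂ ⟶ case t s₁ s₂'
    V0    : ∀ {n t t' s₁ s₂ us} → t ⟶ t' → V n t s₁ s₂ us ⟶ V n t' s₁ s₂ us
    V1    : ∀ {n t s₁ s₁' s₂ us} → s₁ ⟶ s₁' → V n t s₁ s₂ us ⟶ V n t s₁' s₂ us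
    V2    : ∀ {n t s₁ s₂ s₂' us} → s₂ ⟶ s₂' → V n t s₁ s₂ us ⟶ V n t s₁ s₂' us
    Vu    : ∀ {n t s₁ s₂ us us'} → us ⟶v us' → V n t s₁ s₂ us ⟶ V n t s₁ s₂ us'

  data _⟶v_ : ∀ {m} → Vec Term m → Vec Term m → Set where
    here  : ∀ {m u u'} {us : Vec Term m} → u ⟶ u' → (u ∷ us) ⟶v (u' ∷ us)
    there : ∀ {m u} {us us' : Vec Term m} → us ⟶v us' → (u ∷ us) ⟶v (u ∷ us')

Normal : Term → Set
Normal t = ∀ t' → ¬ (t ⟶ t')

NeutralArrow : Term → Set
NeutralArrow t =
  (∃[ W ] ∃[ x ] ∃[ s ] t ≡ fill W (app (var x) s)) ⊎
  (∃[ W ] ∃[ s ] t ≡ fill W (efq s))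

Ctx : Set
Ctx = List Form

infix 4 _∋_∶_ _⊢_∶_

data _∋_∶_ : Ctx → ℕ → Form → Set where
  here  : ∀ {Γ A} → (A ∷ Γ) ∋ zero ∶ A
  there : ∀ {Γ A B k} → Γ ∋ k ∶ A → (B ∷ Γ) ∋ suc k ∶ A

arrows : ∀ {m} → Vec (Form × Form) m → Form → Form
arrows []             E = E
arrows ((B , C) ∷ bs) E = (B ⇒ C) ⇒ arrows bs E

-- context x₁ : B₁→C₁, …, x_m : B_m→C_m  (x_m innermost = index 0)
impCtx : ∀ {m} → Vec (Form × Form) m → Ctx
impCtx bs = reverse (toList (Vec.map (λ bc → proj₁ bc ⇒ proj₂ bc) bs))

data _⊢_∶_ : Ctx → Term → Form → Set where
  ax    : ∀ {Γ k A} → Γ ∋ k ∶ A → Γ ⊢ var k ∶ A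
  ⇒I    : ∀ {Γ t A B} → (A ∷ Γ) ⊢ t ∶ B → Γ ⊢ lam t ∶ A ⇒ B
  ⇒E    : ∀ {Γ t s A B} → Γ ⊢ t ∶ A ⇒ B → Γ ⊢ s ∶ A → Γ ⊢ app t s ∶ B
  ∧I    : ∀ {Γ t s A B} → Γ ⊢ t ∶ A → Γ ⊢ s ∶ B → Γ ⊢ pair t s ∶ A ∧ B
  ∧E    : ∀ {Γ t A₁ A₂} i → Γ ⊢ t ∶ A₁ ∧ A₂ → Γ ⊢ proj i t ∶ sel i A₁ A₂
  ∨I    : ∀ {Γ t A₁ A₂} i → Γ ⊢ t ∶ sel i A₁ A₂ → Γ ⊢ inj i t ∶ A₁ ∨ A₂
  ∨E    : ∀ {Γ t s₁ s₂ A₁ A₂ D} → Γ ⊢ t ∶ A₁ ∨ A₂ →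
          (A₁ ∷ Γ) ⊢ s₁ ∶ D → (A₂ ∷ Γ) ⊢ s₂ ∶ D → Γ ⊢ case t s₁ s₂ ∶ D
  ⊥E    : ∀ {Γ t A} → Γ ⊢ t ∶ ⊥f → Γ ⊢ efq t ∶ A
  visser : ∀ {Γ n t s₁ s₂ A₁ A₂ D} {us : Vec Term (suc n)}
           (bcs : Vec (Form × Form) (suc n)) →
           impCtx bcs ⊢ t ∶ A₁ ∨ A₂ →
           (arrows bcs A₁ ∷ Γ) ⊢ s₁ ∶ D →
           (arrows bcs A₂ ∷ Γ) ⊢ s₂ ∶ D →
           (∀ j → (arrows bcs (proj₁ (lookup bcs j)) ∷ Γ) ⊢ lookup us j ∶ D) →
           Γ ⊢ V n t s₁ s₂ us ∶ D

Implicative : Ctx → Set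
Implicative Γ = All (λ A → ∃[ B ] ∃[ C ] A ≡ B ⇒ C) Γ

module Submission where

-- The heart of the proof is a progress-style dichotomy (normal-form-dichotomy):
-- a normal term typed in an implicative context is either →neutral or
-- canonical, where the canonical terms of a type A are the abstractions and
-- declared variables at arrow types, the injections at disjunctions, and the
-- pairs at conjunctions.  It is proved by induction on the typing derivation:
-- for an elimination form, the induction hypothesis on the principal premise
-- either gives a neutral term, which stays neutral inside a weak head frame,
-- or a canonical one, which produces a redex (contradicting normality) or is
-- a variable at a non-arrow type (impossible in an implicative context).
-- For a Visser term the scrutinee is typed in the implicative context of the
-- x_j, so the same dichotomy applies to it, and each alternative makes the
-- whole term a top-level redex (visser-redex).
-- The theorem then reads the three clauses off the canonical form of t.

open import Defs
open import Data.Nat using (suc; _∸_; _<_; s≤s; z≤n)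
open import Data.Nat.Properties using (m∸[m∸n]≡n; m∸n≤m)
open import Data.Fin using (fromℕ<)
open import Data.Fin.Properties using (toℕ-fromℕ<)
open import Data.Vec using (Vec; []; _∷_; toList)
import Data.Vec as Vec
open import Data.Vec.Properties using (length-toList)
open import Data.List using (List; []; _∷_; reverse; length)
open import Data.List.Properties using (length-reverse)
open import Data.List.Relation.Unary.All using (All; []; _∷_)
import Data.List.Relation.Unary.All as All
open import Data.List.Relation.Unary.Any.Properties using (reverse⁻)
open import Data.Product using (_×_; _,_; ∃; ∃-syntax; proj₁; proj₂)
open import Data.Sum using (_⊎_; inj₁; inj₂)
open import Data.Empty using (⊥-elim)
open import Relation.Binary.PropositionalEquality
  using (_≡_; refl; sym; trans; cong; module ≡-Reasoning)
import Relation.Binary.PropositionalEquality as ≡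
open import Relation.Nullary using (¬_)

IsArrow : Form → Set
IsArrow A = ∃[ B ] ∃[ C ] A ≡ B ⇒ C

implicative-var : ∀ {Γ k A} → Implicative Γ → Γ ∋ k ∶ A → IsArrow A
implicative-var (p ∷ _)  here      = p
implicative-var (_ ∷ ps) (there x) = implicative-var ps x

∋-index< : ∀ {Γ k A} → Γ ∋ k ∶ A → k < length Γ
∋-index< here      = s≤s z≤n
∋-index< (there x) = s≤s (∋-index< x)

All-reverse : ∀ {P : Form → Set} {xs : List Form} → All P xs → All P (reverse xs)
All-reverse ps = All.tabulate (λ x∈ → All.lookup ps (reverse⁻ x∈))

impCtx-implicative : ∀ {m} (bcs : Vec (Form × Form) m) → Implicative (impCtx bcs)
impCtx-implicative bcs = All-reverse (arrows-listed bcs)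
  where
  arrows-listed : ∀ {m} (bcs : Vec (Form × Form) m) →
    All IsArrow (toList (Vec.map (λ bc → proj₁ bc ⇒ proj₂ bc) bcs))
  arrows-listed []              = []
  arrows-listed ((B , C) ∷ bcs) = (B , C , refl) ∷ arrows-listed bcs

impCtx-var< : ∀ {m} (bcs : Vec (Form × Form) m) {x A} → impCtx bcs ∋ x ∶ A → x < m
impCtx-var< {m} bcs {x} x∶A = ≡.subst (x <_) length≡m (∋-index< x∶A)
  where
  bcs′ : Vec Form m
  bcs′ = Vec.map (λ bc → proj₁ bc ⇒ proj₂ bc) bcs
  length≡m : length (impCtx bcs) ≡ m
  length≡m = trans (length-reverse (toList bcs′)) (length-toList bcs′)

bound-variable : ∀ n x → x < suc n → ∃[ j ] x ≡ xIdx n j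
bound-variable n x (s≤s x≤n) = fromℕ< j<1+n , x≡n∸j
  where
  open ≡-Reasoning
  j<1+n : n ∸ x < suc n
  j<1+n = s≤s (m∸n≤m n x)
  x≡n∸j : x ≡ xIdx n (fromℕ< j<1+n)
  x≡n∸j = begin
    x                             ≡⟨ sym (m∸[m∸n]≡n x≤n) ⟩
    n ∸ (n ∸ x)                   ≡⟨ cong (n ∸_) (sym (toℕ-fromℕ< j<1+n)) ⟩
    xIdx n (fromℕ< j<1+n)         ∎

_⊙_ : WCtx → WCtx → WCtx
□             ⊙ W′ = W′
appW W s      ⊙ W′ = appW (W ⊙ W′) s
projW i W     ⊙ W′ = projW i (W ⊙ W′)
caseW W s₁ s₂ ⊙ W′ = caseW (W ⊙ W′) s₁ s₂

fill-⊙ : ∀ W W′ u → fill (W ⊙ W′) u ≡ fill W (fill W′ u)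
fill-⊙ □               W′ u = refl
fill-⊙ (appW W s)      W′ u = cong (λ w → app w s) (fill-⊙ W W′ u)
fill-⊙ (projW i W)     W′ u = cong (proj i) (fill-⊙ W W′ u)
fill-⊙ (caseW W s₁ s₂) W′ u = cong (λ w → case w s₁ s₂) (fill-⊙ W W′ u)

neutral-fill : ∀ W {t} → NeutralArrow t → NeutralArrow (fill W t)
neutral-fill W (inj₁ (W′ , x , s , refl)) =
  inj₁ (W ⊙ W′ , x , s , sym (fill-⊙ W W′ (app (var x) s)))
neutral-fill W (inj₂ (W′ , s , refl)) =
  inj₂ (W ⊙ W′ , s , sym (fill-⊙ W W′ (efq s)))

fill-typed : ∀ {Γ} W {u A} → Γ ⊢ fill W u ∶ A → ∃[ B ] Γ ⊢ u ∶ B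
fill-typed □               d          = _ , d
fill-typed (appW W s)      (⇒E d _)   = fill-typed W d
fill-typed (projW i W)     (∧E _ d)   = fill-typed W d
fill-typed (caseW W s₁ s₂) (∨E d _ _) = fill-typed W d

data Canonical (Γ : Ctx) : Term → Form → Set where
  canLam  : ∀ {t B C} → Canonical Γ (lam t) (B ⇒ C)
  canVar  : ∀ {k A} → Γ ∋ k ∶ A → Canonical Γ (var k) A
  canInj  : ∀ {i t B C} → Canonical Γ (inj i t) (B ∨ C)
  canPair : ∀ {t s B C} → Canonical Γ (pair t s) (B ∧ C)

-- A Visser term whose scrutinee is →neutral or canonical (in the context
-- of the x_j) is a top-level redex, by one of the rules Vin, Vefq, Vapp;
-- for Vapp, the head variable is typed in that context, hence is some x_j.
visser-redex : ∀ {n t s₁ s₂ A₁ A₂} {us : Vec Term (suc n)} (bcs : Vec (Form × Form) (suc n)) →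
  impCtx bcs ⊢ t ∶ A₁ ∨ A₂ →
  NeutralArrow t ⊎ Canonical (impCtx bcs) t (A₁ ∨ A₂) →
  ∃[ t' ] V n t s₁ s₂ us ↦ t'
visser-redex {n} bcs d (inj₁ (inj₁ (W , x , s , refl)))
  with fill-typed W d
... | _ , ⇒E (ax x∶B⇒C) _
  with bound-variable n x (impCtx-var< bcs x∶B⇒C)
... | j , refl = _ , Vapp n W j s _ _ _
visser-redex {n} bcs d (inj₁ (inj₂ (W , s , refl))) = _ , Vefq n W s _ _ _
visser-redex {n} bcs d (inj₂ (canInj {i}))          = _ , Vin n i _ _ _ _
visser-redex bcs d (inj₂ (canVar x)) with implicative-var (impCtx-implicative bcs) x
... | _ , _ , ()

normal-form-dichotomy : ∀ {Γ t A} → Implicative Γ → Γ ⊢ t ∶ A → Normal t →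
  NeutralArrow t ⊎ Canonical Γ t A
normal-form-dichotomy imp (ax x)   nf = inj₂ (canVar x)
normal-form-dichotomy imp (⇒I d)   nf = inj₂ canLam
normal-form-dichotomy imp (∧I d e) nf = inj₂ canPair
normal-form-dichotomy imp (∨I i d) nf = inj₂ canInj
normal-form-dichotomy imp (⊥E {t = t} d) nf = inj₁ (inj₂ (□ , t , refl))
normal-form-dichotomy imp (⇒E {s = s} d e) nf
  with normal-form-dichotomy imp d (λ _ r → nf _ (appL r))
... | inj₁ n                = inj₁ (neutral-fill (appW □ s) n)
... | inj₂ (canLam {t = b}) = ⊥-elim (nf _ (top (β b s)))
... | inj₂ (canVar {k} _)   = inj₁ (inj₁ (□ , k , s , refl))
normal-form-dichotomy imp (∧E i d) nf
  with normal-form-dichotomy imp d (λ _ r → nf _ (projC r))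
... | inj₁ n       = inj₁ (neutral-fill (projW i □) n)
... | inj₂ canPair = ⊥-elim (nf _ (top (πβ i _ _)))
... | inj₂ (canVar x) with implicative-var imp x
...   | _ , _ , ()
normal-form-dichotomy imp (∨E {s₁ = s₁} {s₂} d e f) nf
  with normal-form-dichotomy imp d (λ _ r → nf _ (case0 r))
... | inj₁ n              = inj₁ (neutral-fill (caseW □ s₁ s₂) n)
... | inj₂ (canInj {i})   = ⊥-elim (nf _ (top (caseβ i _ _ _)))
... | inj₂ (canVar x) with implicative-var imp x
...   | _ , _ , ()
normal-form-dichotomy imp (visser bcs d e f g) nf =
  ⊥-elim (nf _ (top (proj₂ (visser-redex bcs d
    (normal-form-dichotomy (impCtx-implicative bcs) d (λ _ r → nf _ (V0 r)))))))

canonical-⇒ : ∀ {Γ t B C} → Canonical Γ t (B ⇒ C) →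
  (∃[ t' ] t ≡ lam t') ⊎ (∃[ k ] (t ≡ var k × Γ ∋ k ∶ B ⇒ C))
canonical-⇒ (canLam {t})  = inj₁ (t , refl)
canonical-⇒ (canVar {k} x) = inj₂ (k , refl , x)

canonical-∨ : ∀ {Γ t B C} → Implicative Γ → Canonical Γ t (B ∨ C) →
  ∃[ i ] ∃[ t' ] t ≡ inj i t'
canonical-∨ imp (canInj {i} {t}) = i , t , refl
canonical-∨ imp (canVar x) with implicative-var imp x
... | _ , _ , ()

canonical-∧ : ∀ {Γ t B C} → Implicative Γ → Canonical Γ t (B ∧ C) →
  ∃[ t₁ ] ∃[ t₂ ] t ≡ pair t₁ t₂
canonical-∧ imp (canPair {t} {s}) = t , s , refl
canonical-∧ imp (canVar x) with implicative-var imp x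
... | _ , _ , ()

mainTheorem3 : ∀ (Γ : Ctx) (t : Term) (A : Form) →
    Implicative Γ → Γ ⊢ t ∶ A → Normal t → ¬ NeutralArrow t →
    (∀ B C → A ≡ B ⇒ C →
       (∃[ t' ] t ≡ lam t') ⊎ (∃[ k ] (t ≡ var k × Γ ∋ k ∶ A))) ×
    (∀ B C → A ≡ B ∨ C → ∃[ i ] ∃[ t' ] t ≡ inj i t') ×
    (∀ B C → A ≡ B ∧ C → ∃[ t₁ ] ∃[ t₂ ] t ≡ pair t₁ t₂)
mainTheorem3 Γ t A imp d nf ¬neutral with normal-form-dichotomy imp d nf
... | inj₁ neutral = ⊥-elim (¬neutral neutral)
... | inj₂ can =
  (λ { B C refl → canonical-⇒ can }) ,
  (λ { B C refl → canonical-∨ imp can }) ,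
  (λ { B C refl → canonical-∧ imp can })
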